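{- For every linear nested sequent $S$, if $S$ is derivable in $\mathsf{LNS}_\mathsf{Kt}$, then $\tau(S)$ is valid.
   Context: Formulae of tense logic $\mathsf{Kt}$ are built from atoms $p$ by $A := p \mid \bot \mid A \to A \mid \Box A \mid \Diamond A \mid \blacksquare A \mid \Diamond^{ -1} A$, where $\Diamond^{ -1}$ denotes the backwards (past) diamond, dual of $\blacksquare$; $\Box,\Diamond$ are interpreted over successors and $\blacksquare,\Diamond^{ -1}$ over predecessors of the Kripke relation $R$; a formula is valid if it is true at every world of every Kripke model. A linear nested sequent is given by $S := \Gamma\Rightarrow\Delta \mid \Gamma\Rightarrow\Delta \nearrow S \mid \Gamma\Rightarrow\Delta \swarrow S$ with $\Gamma,\Delta$ finite multisets of formulae ($\epsilon$ for empty). Its formula translation is $\tau(\Gamma\Rightarrow\Delta)=\bigwedge\Gamma \to \bigvee\Delta$, $\tau(\Gamma\Rightarrow\Delta\nearrow \mathcal{G}) = \bigwedge\Gamma \to (\bigvee\Delta \lor \Box\tau(\mathcal{G}))$, $\tau(\Gamma\Rightarrow\Delta\swarrow \mathcal{G}) = \bigwedge\Gamma \to (\bigvee\Delta \lor \blacksquare\tau(\mathcal{G}))$. The calculus $\mathsf{LNS}_\mathsf{Kt}$ has the following rules, where $\mathcal{G}$ is a possibly empty context and $\ast$ stands for either $\nearrow$ or $\swarrow$ (premisses before "/", conclusion after): $\Box_R^1$: $\mathcal{G}\ast\Gamma\Rightarrow\Delta,A\swarrow\Sigma\Rightarrow\Pi,\Box A$ and $\mathcal{G}\ast\Gamma\Rightarrow\Delta\swarrow\Sigma\Rightarrow\Pi,\Box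 A\nearrow\epsilon\Rightarrow A$ / $\mathcal{G}\ast\Gamma\Rightarrow\Delta\swarrow\Sigma\Rightarrow\Pi,\Box A$; $\blacksquare_R^1$: $\mathcal{G}\ast\Gamma\Rightarrow\Delta,A\nearrow\Sigma\Rightarrow\Pi,\blacksquare A$ and $\mathcal{G}\ast\Gamma\Rightarrow\Delta\nearrow\Sigma\Rightarrow\Pi,\blacksquare A\swarrow\epsilon\Rightarrow A$ / $\mathcal{G}\ast\Gamma\Rightarrow\Delta\nearrow\Sigma\Rightarrow\Pi,\blacksquare A$; $\Box_R^2$: $\mathcal{G}\nearrow\Gamma\Rightarrow\Delta,\Box A\nearrow\epsilon\Rightarrow A$ / $\mathcal{G}\nearrow\Gamma\Rightarrow\Delta,\Box A$; $\blacksquare_R^2$: $\mathcal{G}\swarrow\Gamma\Rightarrow\Delta,\blacksquare A\swarrow\epsilon\Rightarrow A$ / $\mathcal{G}\swarrow\Gamma\Rightarrow\Delta,\blacksquare A$; $\Box_L^1$: $\mathcal{G}\ast\Gamma,\Box A\Rightarrow\Delta\nearrow\Sigma,A\Rightarrow\Pi$ / $\mathcal{G}\ast\Gamma,\Box A\Rightarrow\Delta\nearrow\Sigma\Rightarrow\Pi$; $\blacksquare_L^1$: $\mathcal{G}\ast\Gamma,\blacksquare A\Rightarrow\Delta\swarrow\Sigma,A\Rightarrow\Pi$ / $\mathcal{G}\ast\Gamma,\blacksquare A\Rightarrow\Delta\swarrow\Sigma\Rightarrow\Pi$; $\Box_L^2$: $\mathcal{G}\ast\Gamma,A\Rightarrow\Delta$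 / $\mathcal{G}\ast\Gamma\Rightarrow\Delta\swarrow\Sigma,\Box A\Rightarrow\Pi$; $\blacksquare_L^2$: $\mathcal{G}\ast\Gamma,A\Rightarrow\Delta$ / $\mathcal{G}\ast\Gamma\Rightarrow\Delta\nearrow\Sigma,\blacksquare A\Rightarrow\Pi$; (id): $\mathcal{G}\ast\Gamma,p\Rightarrow p,\Delta$; $\bot_L$: $\mathcal{G}\ast\Gamma,\bot\Rightarrow\Delta$; $\mathsf{EW}$: $\mathcal{G}$ / $\mathcal{G}\ast\Gamma\Rightarrow\Delta$; $\to_R$: $\mathcal{G}\ast\Gamma,A\Rightarrow\Delta,A\to B,B$ / $\mathcal{G}\ast\Gamma\Rightarrow\Delta,A\to B$; $\to_L$: $\mathcal{G}\ast\Gamma,A\to B,B\Rightarrow\Delta$ and $\mathcal{G}\ast\Gamma,A\to B\Rightarrow\Delta,A$ / $\mathcal{G}\ast\Gamma,A\to B\Rightarrow\Delta$. -}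

module Defs where

open import Level using (0ℓ)
open import Data.Nat using (ℕ)
open import Data.List using (List; []; _∷_)
open import Data.List.Membership.Propositional using (_∈_)
open import Data.Product using (Σ; _×_; _,_)
open import Data.Maybe using (Maybe; nothing; just)
open import Data.Empty using (⊥)
open import Axiom.ExcludedMiddle using (ExcludedMiddle)

infixr 5 _⊃_
data Fml : Set where
  atom : ℕ → Fml
  ⊥ᶠ   : Fml
  _⊃_  : Fml → Fml → Fml
  □    : Fml → Fml
  ◇    : Fml → Fml
  ■    : Fml → Fml
  ◇⁻   : Fml → Fml

¬ᶠ : Fml → Fml
¬ᶠ A = A ⊃ ⊥ᶠ

⊤ᶠ : Fml
⊤ᶠ = ⊥ᶠ ⊃ ⊥ᶠ

_∨ᶠ_ : Fml → Fml → Fml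
A ∨ᶠ B = ¬ᶠ A ⊃ B

_∧ᶠ_ : Fml → Fml → Fml
A ∧ᶠ B = ¬ᶠ (A ⊃ ¬ᶠ B)

⋀ : List Fml → Fml
⋀ []      = ⊤ᶠ
⋀ (A ∷ Γ) = A ∧ᶠ ⋀ Γ

⋁ : List Fml → Fml
⋁ []      = ⊥ᶠ
⋁ (A ∷ Δ) = A ∨ᶠ ⋁ Δ

-- Linear nested sequents (multisets represented by lists)

record Seq : Set where
  constructor _⇒_
  field
    ant : List Fml
    suc : List Fml

data Dir : Set where
  ↗ ↙ : Dir

data LNS : Set where
  end   : Seq → LNS
  _⟨_⟩_ : Seq → Dir → LNS → LNS

-- A possibly empty context 𝒢 ∗ (each component together with the
-- nesting symbol following it); plug 𝒢 X = 𝒢 ∗ X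
Ctx : Set
Ctx = List (Seq × Dir)

plug : Ctx → LNS → LNS
plug []            X = X
plug ((s , d) ∷ G) X = s ⟨ d ⟩ plug G X

-- "𝒢 d X" where 𝒢 is possibly empty: either X alone, or 𝒢' ∗ s d X
plugD : Maybe (Ctx × Seq) → Dir → LNS → LNS
plugD nothing        d X = X
plugD (just (G , s)) d X = plug G (s ⟨ d ⟩ X)

snoc : LNS → Dir → Seq → LNS
snoc (end s)     d t = s ⟨ d ⟩ end t
snoc (s ⟨ e ⟩ S) d t = s ⟨ e ⟩ snoc S d t

τ : LNS → Fml
τ (end (Γ ⇒ Δ))         = ⋀ Γ ⊃ ⋁ Δ
τ ((Γ ⇒ Δ) ⟨ ↗ ⟩ S)     = ⋀ Γ ⊃ (⋁ Δ ∨ᶠ □ (τ S))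
τ ((Γ ⇒ Δ) ⟨ ↙ ⟩ S)     = ⋀ Γ ⊃ (⋁ Δ ∨ᶠ ■ (τ S))

-- Principal formulae are retained in the
-- premisses, so each rule is phrased with a membership side condition
-- on the (multiset) component of the conclusion; extra formulae in
-- premisses are consed on.

data ⊢ : LNS → Set where
  □R1 : ∀ G Γ Δ Σ' Π A → □ A ∈ Π →
        ⊢ (plug G ((Γ ⇒ (A ∷ Δ)) ⟨ ↙ ⟩ end (Σ' ⇒ Π))) →
        ⊢ (plug G ((Γ ⇒ Δ) ⟨ ↙ ⟩ ((Σ' ⇒ Π) ⟨ ↗ ⟩ end ([] ⇒ (A ∷ []))))) →
        ⊢ (plug G ((Γ ⇒ Δ) ⟨ ↙ ⟩ end (Σ' ⇒ Π)))
  ■R1 : ∀ G Γ Δ Σ' Π A → ■ A ∈ Π →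
        ⊢ (plug G ((Γ ⇒ (A ∷ Δ)) ⟨ ↗ ⟩ end (Σ' ⇒ Π))) →
        ⊢ (plug G ((Γ ⇒ Δ) ⟨ ↗ ⟩ ((Σ' ⇒ Π) ⟨ ↙ ⟩ end ([] ⇒ (A ∷ []))))) →
        ⊢ (plug G ((Γ ⇒ Δ) ⟨ ↗ ⟩ end (Σ' ⇒ Π)))
  □R2 : ∀ P Γ Δ A → □ A ∈ Δ →
        ⊢ (plugD P ↗ ((Γ ⇒ Δ) ⟨ ↗ ⟩ end ([] ⇒ (A ∷ [])))) →
        ⊢ (plugD P ↗ (end (Γ ⇒ Δ)))
  ■R2 : ∀ P Γ Δ A → ■ A ∈ Δ →
        ⊢ (plugD P ↙ ((Γ ⇒ Δ) ⟨ ↙ ⟩ end ([] ⇒ (A ∷ [])))) →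
        ⊢ (plugD P ↙ (end (Γ ⇒ Δ)))
  □L1 : ∀ G Γ Δ Σ' Π A → □ A ∈ Γ →
        ⊢ (plug G ((Γ ⇒ Δ) ⟨ ↗ ⟩ end ((A ∷ Σ') ⇒ Π))) →
        ⊢ (plug G ((Γ ⇒ Δ) ⟨ ↗ ⟩ end (Σ' ⇒ Π)))
  ■L1 : ∀ G Γ Δ Σ' Π A → ■ A ∈ Γ →
        ⊢ (plug G ((Γ ⇒ Δ) ⟨ ↙ ⟩ end ((A ∷ Σ') ⇒ Π))) →
        ⊢ (plug G ((Γ ⇒ Δ) ⟨ ↙ ⟩ end (Σ' ⇒ Π)))
  □L2 : ∀ G Γ Δ Σ' Π A → □ A ∈ Σ' →
        ⊢ (plug G (end ((A ∷ Γ) ⇒ Δ))) →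
        ⊢ (plug G ((Γ ⇒ Δ) ⟨ ↙ ⟩ end (Σ' ⇒ Π)))
  ■L2 : ∀ G Γ Δ Σ' Π A → ■ A ∈ Σ' →
        ⊢ (plug G (end ((A ∷ Γ) ⇒ Δ))) →
        ⊢ (plug G ((Γ ⇒ Δ) ⟨ ↗ ⟩ end (Σ' ⇒ Π)))
  id  : ∀ G Γ Δ p → atom p ∈ Γ → atom p ∈ Δ →
        ⊢ (plug G (end (Γ ⇒ Δ)))
  ⊥L  : ∀ G Γ Δ → ⊥ᶠ ∈ Γ →
        ⊢ (plug G (end (Γ ⇒ Δ)))
  EW  : ∀ S d Γ Δ →
        ⊢ S →
        ⊢ (snoc S d (Γ ⇒ Δ))
  ⊃R  : ∀ G Γ Δ A B → (A ⊃ B) ∈ Δ →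
        ⊢ (plug G (end ((A ∷ Γ) ⇒ (B ∷ Δ)))) →
        ⊢ (plug G (end (Γ ⇒ Δ)))
  ⊃L  : ∀ G Γ Δ A B → (A ⊃ B) ∈ Γ →
        ⊢ (plug G (end ((B ∷ Γ) ⇒ Δ))) →
        ⊢ (plug G (end (Γ ⇒ (A ∷ Δ)))) →
        ⊢ (plug G (end (Γ ⇒ Δ)))

record Model : Set₁ where
  field
    W : Set
    R : W → W → Set
    V : ℕ → W → Set

_,_⊨_ : (M : Model) → Model.W M → Fml → Set
M , w ⊨ atom p = Model.V M p w
M , w ⊨ ⊥ᶠ     = ⊥
M , w ⊨ (A ⊃ B) = M , w ⊨ A → M , w ⊨ B
M , w ⊨ □ A    = ∀ v → Model.R M w v → M , v ⊨ A
M , w ⊨ ◇ A    = Σ (Model.W M) λ v → Model.R M w v × M , v ⊨ A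
M , w ⊨ ■ A    = ∀ v → Model.R M v w → M , v ⊨ A
M , w ⊨ ◇⁻ A   = Σ (Model.W M) λ v → Model.R M v w × M , v ⊨ A

Valid : Fml → Set₁
Valid A = (M : Model) (w : Model.W M) → M , w ⊨ A

module Submission where

-- Read a linear nested sequent at a world w of a model as the proposition that, if every
-- antecedent of its first component holds at w, then some succedent holds at w or, along the
-- direction of the nesting, every successor (↗) or predecessor (↙) satisfies the rest.
-- Every rule is sound for this reading at the component it acts on, and the reading is monotone
-- under plugging into a context, so derivable sequents hold everywhere. Classical logic enters
-- only in the two rules that case on a formula (□L2/■L2 and ⊃R) and in matching the reading with
-- τ, whose ∧ and ∨ are the classical encodings. By the tense symmetry, each pair of modal rules
-- (□/■) is a single rule read along opposite directions of R.

open import Level using (0ℓ)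
open import Axiom.ExcludedMiddle using (ExcludedMiddle)
open import Axiom.DoubleNegationElimination using (em⇒dne)
open import Defs
open import Data.List using ([]; _∷_)
open import Data.List.Membership.Propositional using (_∈_; lose)
open import Data.List.Relation.Unary.All as All using (All; []; _∷_)
open import Data.List.Relation.Unary.Any using (Any; here; there)
open import Data.Product using (_×_; _,_)
open import Data.Sum as Sum using (_⊎_; inj₁; inj₂)
open import Data.Maybe using (nothing; just)
open import Data.Empty using (⊥-elim)
open import Relation.Nullary using (yes; no)

box : Dir → Fml → Fml
box ↗ = □
box ↙ = ■

rev : Dir → Dir
rev ↗ = ↙
rev ↙ = ↗

module Semantics (M : Model) where
  open Model M

  _⊩_ : W → Fml → Set
  w ⊩ A = M , w ⊨ A

  Rel : Dir → W → W → Set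
  Rel ↗ w v = R w v
  Rel ↙ w v = R v w

  [_]_ : Dir → (W → Set) → W → Set
  ([ d ] P) w = ∀ v → Rel d w v → P v

  box-intro : ∀ d {A w} → ([ d ] (_⊩ A)) w → w ⊩ box d A
  box-intro ↗ h = h
  box-intro ↙ h = h

  box-elim : ∀ d {A w} → w ⊩ box d A → ([ d ] (_⊩ A)) w
  box-elim ↗ h = h
  box-elim ↙ h = h

  Rel-rev : ∀ d {w v} → Rel (rev d) w v → Rel d v w
  Rel-rev ↗ r = r
  Rel-rev ↙ r = r

  ⟦_⟧ : LNS → W → Set
  ⟦ end (Γ ⇒ Δ) ⟧ w     = All (w ⊩_) Γ → Any (w ⊩_) Δ
  ⟦ (Γ ⇒ Δ) ⟨ d ⟩ S ⟧ w = All (w ⊩_) Γ → Any (w ⊩_) Δ ⊎ ([ d ] ⟦ S ⟧) w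

  infix 4 _⇛_
  _⇛_ : LNS → LNS → Set
  X ⇛ Y = ∀ w → ⟦ X ⟧ w → ⟦ Y ⟧ w

  ⟨⟩-mono₂ : ∀ s d {X Y Z} → (∀ w → ⟦ X ⟧ w → ⟦ Y ⟧ w → ⟦ Z ⟧ w) →
             ∀ w → ⟦ s ⟨ d ⟩ X ⟧ w → ⟦ s ⟨ d ⟩ Y ⟧ w → ⟦ s ⟨ d ⟩ Z ⟧ w
  ⟨⟩-mono₂ (Γ ⇒ Δ) d f w p q γ with p γ | q γ
  ... | inj₁ δ | _      = inj₁ δ
  ... | inj₂ _ | inj₁ δ = inj₁ δ
  ... | inj₂ x | inj₂ y = inj₂ λ v r → f v (x v r) (y v r)

  plug-mono₂ : ∀ G {X Y Z} → (∀ w → ⟦ X ⟧ w → ⟦ Y ⟧ w → ⟦ Z ⟧ w) →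
               ∀ w → ⟦ plug G X ⟧ w → ⟦ plug G Y ⟧ w → ⟦ plug G Z ⟧ w
  plug-mono₂ []            f = f
  plug-mono₂ ((s , d) ∷ G) f = ⟨⟩-mono₂ s d (plug-mono₂ G f)

  ⟨⟩-mono : ∀ s d {X Y} → X ⇛ Y → s ⟨ d ⟩ X ⇛ s ⟨ d ⟩ Y
  ⟨⟩-mono s d {X} f w x = ⟨⟩-mono₂ s d {X} {X} (λ v a _ → f v a) w x x

  plug-mono : ∀ G {X Y} → X ⇛ Y → plug G X ⇛ plug G Y
  plug-mono G {X} f w x = plug-mono₂ G {X} {X} (λ v a _ → f v a) w x x

  plugD-mono : ∀ P d {X Y} → X ⇛ Y → plugD P d X ⇛ plugD P d Y
  plugD-mono nothing        d f = f
  plugD-mono (just (G , s)) d f = plug-mono G (⟨⟩-mono s d f)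

  plug-valid : ∀ G {X} → (∀ w → ⟦ X ⟧ w) → ∀ w → ⟦ plug G X ⟧ w
  plug-valid []                  f = f
  plug-valid (((Γ ⇒ Δ) , d) ∷ G) f w _ = inj₂ λ v _ → plug-valid G f v

  snoc-weaken : ∀ S d s → S ⇛ snoc S d s
  snoc-weaken (end (Γ ⇒ Δ)) d s w p γ = inj₁ (p γ)
  snoc-weaken (t ⟨ e ⟩ S)   d s       = ⟨⟩-mono t e (snoc-weaken S d s)

  singleton-holds : ∀ {A w} → ⟦ end ([] ⇒ (A ∷ [])) ⟧ w → w ⊩ A
  singleton-holds h with h []
  ... | here a = a

  boxR-local : ∀ d Γ Δ A → box d A ∈ Δ →
               (Γ ⇒ Δ) ⟨ d ⟩ end ([] ⇒ (A ∷ [])) ⇛ end (Γ ⇒ Δ)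
  boxR-local d Γ Δ A m w p γ with p γ
  ... | inj₁ δ = δ
  ... | inj₂ b = lose m (box-intro d λ v r → singleton-holds (b v r))

  boxR₁-local : ∀ d e Γ Δ Σ' Π A → box d A ∈ Π →
                (Γ ⇒ Δ) ⟨ e ⟩ ((Σ' ⇒ Π) ⟨ d ⟩ end ([] ⇒ (A ∷ []))) ⇛ (Γ ⇒ Δ) ⟨ e ⟩ end (Σ' ⇒ Π)
  boxR₁-local d e Γ Δ Σ' Π A m =
    ⟨⟩-mono (Γ ⇒ Δ) e {X = (Σ' ⇒ Π) ⟨ d ⟩ end ([] ⇒ (A ∷ []))} {Y = end (Σ' ⇒ Π)}
      (boxR-local d Σ' Π A m)

  boxL₁-local : ∀ d Γ Δ Σ' Π A → box d A ∈ Γ →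
                (Γ ⇒ Δ) ⟨ d ⟩ end ((A ∷ Σ') ⇒ Π) ⇛ (Γ ⇒ Δ) ⟨ d ⟩ end (Σ' ⇒ Π)
  boxL₁-local d Γ Δ Σ' Π A m w p γ with p γ
  ... | inj₁ δ = inj₁ δ
  ... | inj₂ b = inj₂ λ v r σ → b v r (box-elim d (All.lookup γ m) v r ∷ σ)

  ⊃L-local : ∀ Γ Δ A B → (A ⊃ B) ∈ Γ → ∀ w →
             ⟦ end ((B ∷ Γ) ⇒ Δ) ⟧ w → ⟦ end (Γ ⇒ (A ∷ Δ)) ⟧ w → ⟦ end (Γ ⇒ Δ) ⟧ w
  ⊃L-local Γ Δ A B m w p q γ with q γ
  ... | here a  = p (All.lookup γ m a ∷ γ)
  ... | there δ = δ

  id-local : ∀ Γ Δ p → atom p ∈ Γ → atom p ∈ Δ → ∀ w → ⟦ end (Γ ⇒ Δ) ⟧ w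
  id-local Γ Δ p m₁ m₂ w γ = lose m₂ (All.lookup γ m₁)

  ⊥L-local : ∀ Γ Δ → ⊥ᶠ ∈ Γ → ∀ w → ⟦ end (Γ ⇒ Δ) ⟧ w
  ⊥L-local Γ Δ m w γ = ⊥-elim (All.lookup γ m)

  ∨ᶠ-from-⊎ : ∀ A B {w} → w ⊩ A ⊎ w ⊩ B → w ⊩ (A ∨ᶠ B)
  ∨ᶠ-from-⊎ _ _ (inj₁ a) ¬a = ⊥-elim (¬a a)
  ∨ᶠ-from-⊎ _ _ (inj₂ b) _  = b

  ⋁-intro : ∀ {Δ w} → Any (w ⊩_) Δ → w ⊩ ⋁ Δ
  ⋁-intro (here a)  ¬a = ⊥-elim (¬a a)
  ⋁-intro (there δ) _  = ⋁-intro δ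

  module _ (em : ExcludedMiddle 0ℓ) where

    boxL₂-local : ∀ d Γ Δ Σ' Π A → box d A ∈ Σ' →
                  end ((A ∷ Γ) ⇒ Δ) ⇛ (Γ ⇒ Δ) ⟨ rev d ⟩ end (Σ' ⇒ Π)
    boxL₂-local d Γ Δ Σ' Π A m w p γ with em {w ⊩ A}
    ... | yes a = inj₁ (p (a ∷ γ))
    ... | no ¬a = inj₂ λ v r σ → ⊥-elim (¬a (box-elim d (All.lookup σ m) w (Rel-rev d r)))

    ⊃R-local : ∀ Γ Δ A B → (A ⊃ B) ∈ Δ → end ((A ∷ Γ) ⇒ (B ∷ Δ)) ⇛ end (Γ ⇒ Δ)
    ⊃R-local Γ Δ A B m w p γ with em {w ⊩ A}
    ... | no ¬a = lose m λ a → ⊥-elim (¬a a)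
    ... | yes a with p (a ∷ γ)
    ...   | here b  = lose m λ _ → b
    ...   | there δ = δ

    sound : ∀ {S} → ⊢ S → ∀ w → ⟦ S ⟧ w
    sound (□R1 G Γ Δ Σ' Π A m _ d) w = plug-mono G (boxR₁-local ↗ ↙ Γ Δ Σ' Π A m) w (sound d w)
    sound (■R1 G Γ Δ Σ' Π A m _ d) w = plug-mono G (boxR₁-local ↙ ↗ Γ Δ Σ' Π A m) w (sound d w)
    sound (□R2 P Γ Δ A m d)        w = plugD-mono P ↗ (boxR-local ↗ Γ Δ A m) w (sound d w)
    sound (■R2 P Γ Δ A m d)        w = plugD-mono P ↙ (boxR-local ↙ Γ Δ A m) w (sound d w)
    sound (□L1 G Γ Δ Σ' Π A m d)   w = plug-mono G (boxL₁-local ↗ Γ Δ Σ' Π A m) w (sound d w)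
    sound (■L1 G Γ Δ Σ' Π A m d)   w = plug-mono G (boxL₁-local ↙ Γ Δ Σ' Π A m) w (sound d w)
    sound (□L2 G Γ Δ Σ' Π A m d)   w = plug-mono G (boxL₂-local ↗ Γ Δ Σ' Π A m) w (sound d w)
    sound (■L2 G Γ Δ Σ' Π A m d)   w = plug-mono G (boxL₂-local ↙ Γ Δ Σ' Π A m) w (sound d w)
    sound (id G Γ Δ p m₁ m₂)       w = plug-valid G (id-local Γ Δ p m₁ m₂) w
    sound (⊥L G Γ Δ m)             w = plug-valid G (⊥L-local Γ Δ m) w
    sound (EW S e Γ Δ d)           w = snoc-weaken S e (Γ ⇒ Δ) w (sound d w)
    sound (⊃R G Γ Δ A B m d)       w = plug-mono G (⊃R-local Γ Δ A B m) w (sound d w)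
    sound (⊃L G Γ Δ A B m d₁ d₂)   w = plug-mono₂ G (⊃L-local Γ Δ A B m) w (sound d₁ w) (sound d₂ w)

    ∧ᶠ-elim : ∀ A B {w} → w ⊩ (A ∧ᶠ B) → w ⊩ A × w ⊩ B
    ∧ᶠ-elim _ _ h = em⇒dne em (λ ¬a → h λ a _ → ¬a a) , em⇒dne em (λ ¬b → h λ _ b → ¬b b)

    ⋀-elim : ∀ {Γ w} → w ⊩ ⋀ Γ → All (w ⊩_) Γ
    ⋀-elim {[]}    _ = []
    ⋀-elim {A ∷ Γ} h with ∧ᶠ-elim A (⋀ Γ) h
    ... | a , γ = a ∷ ⋀-elim γ

    ⟦⟧⇒τ : ∀ S w → ⟦ S ⟧ w → w ⊩ τ S
    ⟦⟧⇒τ (end (Γ ⇒ Δ))     w p h = ⋁-intro (p (⋀-elim h))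
    ⟦⟧⇒τ ((Γ ⇒ Δ) ⟨ ↗ ⟩ S) w p h =
      ∨ᶠ-from-⊎ (⋁ Δ) (□ (τ S)) (Sum.map ⋁-intro (λ b v r → ⟦⟧⇒τ S v (b v r)) (p (⋀-elim h)))
    ⟦⟧⇒τ ((Γ ⇒ Δ) ⟨ ↙ ⟩ S) w p h =
      ∨ᶠ-from-⊎ (⋁ Δ) (■ (τ S)) (Sum.map ⋁-intro (λ b v r → ⟦⟧⇒τ S v (b v r)) (p (⋀-elim h)))

corollary5 : ExcludedMiddle 0ℓ → (S : LNS) → ⊢ S → Valid (τ S)
corollary5 em S d M w = ⟦⟧⇒τ em S w (sound em d w)
  where open Semantics M
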